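{- A formula $A$ is a theorem of the intuitionistic modal logic $IK$ if and only if there is a term $t$ such that $\cdot\vdash t:A$ is derivable in the Fitch-style calculus for $IK$ (that is, $A$ is an inhabited type in the empty context).
   Context: Formulas/types: $A,B ::= p \mid 1 \mid A\times B \mid A\to B \mid 0 \mid A+B \mid \Box A$, with $p$ ranging over propositional atoms ($1,\times,\to,0,+$ read as truth, conjunction, implication, falsity, disjunction). The logic $IK$ is intuitionistic propositional logic in this language extended with the axiom K: $\Box(A\to B)\to\Box A\to\Box B$ and the rule of necessitation (if $A$ is a theorem then so is $\Box A$), closed under modus ponens. The calculus. Contexts are given by $\Gamma ::= \cdot \mid \Gamma,x:A \mid \Gamma,\bullet$, where $x$ is a variable not already in $\Gamma$ and $\bullet$ is a structural symbol called a lock. Terms: $x$, $\langle\rangle$, $\langle t,u\rangle$, $\pi_1 t$, $\pi_2 t$, $\lambda x.t$, $t\,u$, $\mathrm{inl}\,t$, $\mathrm{inr}\,t$, $\mathrm{case}\ s\ \mathrm{of}\ (x.t;\,y.u)$, $\mathrm{abort}\,t$, $\mathrm{shut}\,t$, $\mathrm{open}\,t$. Typing rules: (var) $\Gamma,x:A,\Gamma'\vdash x:A$ provided $\Gamma'$ contains no lock; (products) $\Gamma\vdash\langle\rangle:1$; from $\Gamma\vdash t:A$ and $\Gamma\vdash u:B$ infer $\Gamma\vdash\langle t,u\rangle:A\times B$; from $\Gamma\vdash t:A_1\times A_2$ infer $\Gamma\vdash\pi_i t:A_i$; (functions) from $\Gamma,x:A\vdash t:B$ infer $\Gamma\vdash\lambda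 x.t:A\to B$; from $\Gamma\vdash t:A\to B$ and $\Gamma\vdash u:A$ infer $\Gamma\vdash t\,u:B$; (sums) from $\Gamma\vdash t:A$ infer $\Gamma\vdash\mathrm{inl}\,t:A+B$; from $\Gamma\vdash t:B$ infer $\Gamma\vdash\mathrm{inr}\,t:A+B$; from $\Gamma\vdash s:A+B$, $\Gamma,x:A,\Gamma'\vdash t:C$ and $\Gamma,y:B,\Gamma'\vdash u:C$ infer $\Gamma,\Gamma'\vdash\mathrm{case}\ s\ \mathrm{of}\ (x.t;\,y.u):C$ (any $\Gamma'$); from $\Gamma\vdash t:0$ infer $\Gamma,\Gamma'\vdash\mathrm{abort}\,t:A$ (any $\Gamma'$); (shut) from $\Gamma,\bullet\vdash t:A$ infer $\Gamma\vdash\mathrm{shut}\,t:\Box A$; (open) from $\Gamma\vdash t:\Box A$ infer $\Gamma,\bullet,\Gamma'\vdash\mathrm{open}\,t:A$ provided $\Gamma'$ contains no lock. -}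

module Defs where

open import Data.Nat using (ℕ)
open import Data.Unit using (⊤)
open import Data.Empty using (⊥)
open import Data.Product using (_×_)
open import Relation.Binary.PropositionalEquality using (_≢_)

infixr 7 _⇒_
infixr 8 _⊕_
infixr 9 _⊗_

data Form : Set where
  atom : ℕ → Form
  𝟙    : Form
  _⊗_  : Form → Form → Form
  _⇒_  : Form → Form → Form
  𝟘    : Form
  _⊕_  : Form → Form → Form
  □_   : Form → Form

data IK : Form → Set where
  ax-k    : ∀ {A B} → IK (A ⇒ B ⇒ A)
  ax-s    : ∀ {A B C} → IK ((A ⇒ B ⇒ C) ⇒ (A ⇒ B) ⇒ A ⇒ C)
  ax-one  : IK 𝟙
  ax-fst  : ∀ {A B} → IK (A ⊗ B ⇒ A)
  ax-snd  : ∀ {A B} → IK (A ⊗ B ⇒ B)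
  ax-pair : ∀ {A B} → IK (A ⇒ B ⇒ A ⊗ B)
  ax-inl  : ∀ {A B} → IK (A ⇒ A ⊕ B)
  ax-inr  : ∀ {A B} → IK (B ⇒ A ⊕ B)
  ax-case : ∀ {A B C} → IK ((A ⇒ C) ⇒ (B ⇒ C) ⇒ A ⊕ B ⇒ C)
  ax-efq  : ∀ {A} → IK (𝟘 ⇒ A)
  ax-K    : ∀ {A B} → IK (□ (A ⇒ B) ⇒ □ A ⇒ □ B)
  mp      : ∀ {A B} → IK (A ⇒ B) → IK A → IK B
  nec     : ∀ {A} → IK A → IK (□ A)

Var : Set
Var = ℕ

data Tm : Set where
  var   : Var → Tm
  unit  : Tm
  pair  : Tm → Tm → Tm
  π₁    : Tm → Tm
  π₂    : Tm → Tm
  lam   : Var → Tm → Tm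
  app   : Tm → Tm → Tm
  inl   : Tm → Tm
  inr   : Tm → Tm
  case  : Tm → Var → Tm → Var → Tm → Tm
  abort : Tm → Tm
  shut  : Tm → Tm
  open' : Tm → Tm

infixl 5 _,_∶_ _,• _,,_
data Ctx : Set where
  ·      : Ctx
  _,_∶_  : Ctx → Var → Form → Ctx
  _,•    : Ctx → Ctx

_,,_ : Ctx → Ctx → Ctx
Γ ,, ·          = Γ
Γ ,, (Δ , x ∶ A) = (Γ ,, Δ) , x ∶ A
Γ ,, (Δ ,•)      = (Γ ,, Δ) ,•

_#_ : Var → Ctx → Set
x # ·           = ⊤
x # (Γ , y ∶ A) = (x ≢ y) × (x # Γ)
x # (Γ ,•)      = x # Γ

LockFree : Ctx → Set
LockFree ·           = ⊤
LockFree (Γ , x ∶ A) = LockFree Γ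
LockFree (Γ ,•)      = ⊥

infix 3 _⊢_∶_
data _⊢_∶_ : Ctx → Tm → Form → Set where
  ⊢var   : ∀ {Γ Γ' x A} → LockFree Γ' → ((Γ , x ∶ A) ,, Γ') ⊢ var x ∶ A
  ⊢unit  : ∀ {Γ} → Γ ⊢ unit ∶ 𝟙
  ⊢pair  : ∀ {Γ t u A B} → Γ ⊢ t ∶ A → Γ ⊢ u ∶ B → Γ ⊢ pair t u ∶ A ⊗ B
  ⊢π₁    : ∀ {Γ t A B} → Γ ⊢ t ∶ A ⊗ B → Γ ⊢ π₁ t ∶ A
  ⊢π₂    : ∀ {Γ t A B} → Γ ⊢ t ∶ A ⊗ B → Γ ⊢ π₂ t ∶ B
  ⊢lam   : ∀ {Γ x t A B} → x # Γ → (Γ , x ∶ A) ⊢ t ∶ B → Γ ⊢ lam x t ∶ A ⇒ B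
  ⊢app   : ∀ {Γ t u A B} → Γ ⊢ t ∶ A ⇒ B → Γ ⊢ u ∶ A → Γ ⊢ app t u ∶ B
  ⊢inl   : ∀ {Γ t A B} → Γ ⊢ t ∶ A → Γ ⊢ inl t ∶ A ⊕ B
  ⊢inr   : ∀ {Γ t A B} → Γ ⊢ t ∶ B → Γ ⊢ inr t ∶ A ⊕ B
  ⊢case  : ∀ {Γ Γ' s x t y u A B C}
         → x # (Γ ,, Γ') → y # (Γ ,, Γ')
         → Γ ⊢ s ∶ A ⊕ B
         → ((Γ , x ∶ A) ,, Γ') ⊢ t ∶ C
         → ((Γ , y ∶ B) ,, Γ') ⊢ u ∶ C
         → (Γ ,, Γ') ⊢ case s x t y u ∶ C
  ⊢abort : ∀ {Γ Γ' t A} → Γ ⊢ t ∶ 𝟘 → (Γ ,, Γ') ⊢ abort t ∶ A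
  ⊢shut  : ∀ {Γ t A} → (Γ ,•) ⊢ t ∶ A → Γ ⊢ shut t ∶ □ A
  ⊢open  : ∀ {Γ Γ' t A} → LockFree Γ' → Γ ⊢ t ∶ □ A → ((Γ ,•) ,, Γ') ⊢ open' t ∶ A

-- Soundness: read a context as a prefix of implications and boxes, so that
-- Γ ⊢ t ∶ A yields the IK-theorem ⟦ Γ ⟧ A. Each prefix ⟦ Γ ⟧ is an applicative
-- functor on IK-theorems (pure by K-combinator and necessitation, ap by the
-- S and K axioms), which interprets every typing rule; shut and lam are free.
-- Completeness: each Hilbert axiom is a closed term, modus ponens is
-- application and necessitation is shut.
module Submission where

open import Defs
open import Data.Nat using (ℕ; zero; suc; _+_)
open import Data.Product using (Σ; _,_)
open import Data.Unit using (tt)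
open import Function.Bundles using (_⇔_; mk⇔)
open import Relation.Binary.PropositionalEquality using (_≡_; refl; subst; sym)

⇒-refl : ∀ {A} → IK (A ⇒ A)
⇒-refl {A} = mp (mp ax-s ax-k) (ax-k {B = A})

⇒-trans : ∀ {A B C} → IK (A ⇒ B) → IK (B ⇒ C) → IK (A ⇒ C)
⇒-trans f g = mp (mp ax-s (mp ax-k g)) f

⟦_⟧_ : Ctx → Form → Form
⟦ · ⟧ A         = A
⟦ Γ , x ∶ B ⟧ A = ⟦ Γ ⟧ (B ⇒ A)
⟦ Γ ,• ⟧ A      = ⟦ Γ ⟧ (□ A)

⟦,,⟧ : ∀ Γ Δ C → ⟦ Γ ,, Δ ⟧ C ≡ ⟦ Γ ⟧ (⟦ Δ ⟧ C)
⟦,,⟧ Γ · C           = refl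
⟦,,⟧ Γ (Δ , x ∶ B) C = ⟦,,⟧ Γ Δ (B ⇒ C)
⟦,,⟧ Γ (Δ ,•) C      = ⟦,,⟧ Γ Δ (□ C)

⟦,,⟧-split : ∀ Γ Δ {C} → IK (⟦ Γ ,, Δ ⟧ C) → IK (⟦ Γ ⟧ (⟦ Δ ⟧ C))
⟦,,⟧-split Γ Δ {C} = subst IK (⟦,,⟧ Γ Δ C)

⟦,,⟧-join : ∀ Γ Δ {C} → IK (⟦ Γ ⟧ (⟦ Δ ⟧ C)) → IK (⟦ Γ ,, Δ ⟧ C)
⟦,,⟧-join Γ Δ {C} = subst IK (sym (⟦,,⟧ Γ Δ C))

⟦⟧-pure : ∀ Γ {A} → IK A → IK (⟦ Γ ⟧ A)
⟦⟧-pure ·           a = a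
⟦⟧-pure (Γ , x ∶ B) a = ⟦⟧-pure Γ (mp ax-k a)
⟦⟧-pure (Γ ,•)      a = ⟦⟧-pure Γ (nec a)

⟦⟧-ap : ∀ Γ {A B} → IK (⟦ Γ ⟧ (A ⇒ B)) → IK (⟦ Γ ⟧ A) → IK (⟦ Γ ⟧ B)
⟦⟧-ap ·           f a = mp f a
⟦⟧-ap (Γ , x ∶ C) f a = ⟦⟧-ap Γ (⟦⟧-ap Γ (⟦⟧-pure Γ ax-s) f) a
⟦⟧-ap (Γ ,•)      f a = ⟦⟧-ap Γ (⟦⟧-ap Γ (⟦⟧-pure Γ ax-K) f) a

⟦⟧-map : ∀ Γ {A B} → IK (A ⇒ B) → IK (⟦ Γ ⟧ A) → IK (⟦ Γ ⟧ B)
⟦⟧-map Γ f = ⟦⟧-ap Γ (⟦⟧-pure Γ f)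

⟦⟧-weaken : ∀ Δ {A} → LockFree Δ → IK (A ⇒ ⟦ Δ ⟧ A)
⟦⟧-weaken ·           _  = ⇒-refl
⟦⟧-weaken (Δ , y ∶ B) lf = ⇒-trans ax-k (⟦⟧-weaken Δ lf)
⟦⟧-weaken (Δ ,•)      ()

soundness : ∀ {Γ t A} → Γ ⊢ t ∶ A → IK (⟦ Γ ⟧ A)
soundness (⊢var {Γ} {Γ'} {x} {A} lf) =
  ⟦,,⟧-join (Γ , x ∶ A) Γ' (⟦⟧-pure Γ (⟦⟧-weaken Γ' lf))
soundness {Γ} ⊢unit       = ⟦⟧-pure Γ ax-one
soundness {Γ} (⊢pair p q) = ⟦⟧-ap Γ (⟦⟧-map Γ ax-pair (soundness p)) (soundness q)
soundness {Γ} (⊢π₁ p)     = ⟦⟧-map Γ ax-fst (soundness p)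
soundness {Γ} (⊢π₂ p)     = ⟦⟧-map Γ ax-snd (soundness p)
soundness (⊢lam _ d)      = soundness d
soundness {Γ} (⊢app p q)  = ⟦⟧-ap Γ (soundness p) (soundness q)
soundness {Γ} (⊢inl p)    = ⟦⟧-map Γ ax-inl (soundness p)
soundness {Γ} (⊢inr p)    = ⟦⟧-map Γ ax-inr (soundness p)
soundness (⊢case {Γ} {Γ'} {x = x} {y = y} {A = A} {B} _ _ ds dt du) =
  ⟦,,⟧-join Γ Γ' (⟦⟧-ap Γ (⟦⟧-ap Γ (⟦⟧-map Γ ax-case left) right) (soundness ds))
  where
  left  = ⟦,,⟧-split (Γ , x ∶ A) Γ' (soundness dt)
  right = ⟦,,⟧-split (Γ , y ∶ B) Γ' (soundness du)
soundness (⊢abort {Γ} {Γ'} d) = ⟦,,⟧-join Γ Γ' (⟦⟧-map Γ ax-efq (soundness d))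
soundness (⊢shut d)           = soundness d
soundness (⊢open {Γ} {Γ'} lf d) =
  ⟦,,⟧-join (Γ ,•) Γ' (⟦⟧-map Γ (mp ax-K (nec (⟦⟧-weaken Γ' lf))) (soundness d))

locks : ℕ → Ctx
locks zero    = ·
locks (suc n) = locks n ,•

#-locks : ∀ {x} n → x # locks n
#-locks zero    = tt
#-locks (suc n) = #-locks n

-- Necessitation moves a derivation under a lock, so completeness must hold
-- in every context consisting of locks only.
completeness : ∀ {A} → IK A → ∀ n → Σ Tm (λ t → locks n ⊢ t ∶ A)
completeness (ax-k {A} {B}) n =
  lam 0 (lam 1 (var 0)) ,
  ⊢lam (#-locks n) (⊢lam ((λ ()) , #-locks n) (⊢var {Γ' = · , 1 ∶ B} tt))
completeness (ax-s {A} {B} {C}) n =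
  lam 0 (lam 1 (lam 2 (app (app (var 0) (var 2)) (app (var 1) (var 2))))) ,
  ⊢lam (#-locks n) (⊢lam ((λ ()) , #-locks n) (⊢lam ((λ ()) , (λ ()) , #-locks n)
    (⊢app (⊢app (⊢var {Γ' = · , 1 ∶ (A ⇒ B) , 2 ∶ A} tt) (⊢var {Γ' = ·} tt))
          (⊢app (⊢var {Γ' = · , 2 ∶ A} tt) (⊢var {Γ' = ·} tt)))))
completeness ax-one n = unit , ⊢unit
completeness ax-fst n = lam 0 (π₁ (var 0)) , ⊢lam (#-locks n) (⊢π₁ (⊢var {Γ' = ·} tt))
completeness ax-snd n = lam 0 (π₂ (var 0)) , ⊢lam (#-locks n) (⊢π₂ (⊢var {Γ' = ·} tt))
completeness (ax-pair {A} {B}) n =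
  lam 0 (lam 1 (pair (var 0) (var 1))) ,
  ⊢lam (#-locks n) (⊢lam ((λ ()) , #-locks n)
    (⊢pair (⊢var {Γ' = · , 1 ∶ B} tt) (⊢var {Γ' = ·} tt)))
completeness ax-inl n = lam 0 (inl (var 0)) , ⊢lam (#-locks n) (⊢inl (⊢var {Γ' = ·} tt))
completeness ax-inr n = lam 0 (inr (var 0)) , ⊢lam (#-locks n) (⊢inr (⊢var {Γ' = ·} tt))
completeness (ax-case {A} {B} {C}) n =
  lam 0 (lam 1 (lam 2 (case (var 2) 3 (app (var 0) (var 3)) 4 (app (var 1) (var 4))))) ,
  ⊢lam (#-locks n) (⊢lam ((λ ()) , #-locks n) (⊢lam ((λ ()) , (λ ()) , #-locks n)
    (⊢case {Γ' = ·} fresh fresh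
      (⊢var {Γ' = ·} tt)
      (⊢app (⊢var {Γ' = · , 1 ∶ (B ⇒ C) , 2 ∶ (A ⊕ B) , 3 ∶ A} tt) (⊢var {Γ' = ·} tt))
      (⊢app (⊢var {Γ' = · , 2 ∶ (A ⊕ B) , 4 ∶ B} tt) (⊢var {Γ' = ·} tt)))))
  where
  fresh : ∀ {z} → (3 + z) # (locks n , 0 ∶ (A ⇒ C) , 1 ∶ (B ⇒ C) , 2 ∶ (A ⊕ B))
  fresh = (λ ()) , (λ ()) , (λ ()) , #-locks n
completeness ax-efq n =
  lam 0 (abort (var 0)) , ⊢lam (#-locks n) (⊢abort {Γ' = ·} (⊢var {Γ' = ·} tt))
completeness (ax-K {A} {B}) n =
  lam 0 (lam 1 (shut (app (open' (var 0)) (open' (var 1))))) ,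
  ⊢lam (#-locks n) (⊢lam ((λ ()) , #-locks n) (⊢shut
    (⊢app (⊢open {Γ' = ·} tt (⊢var {Γ' = · , 1 ∶ □ A} tt))
          (⊢open {Γ' = ·} tt (⊢var {Γ' = ·} tt)))))
completeness (mp p q) n =
  let t , dt = completeness p n
      u , du = completeness q n
  in app t u , ⊢app dt du
completeness (nec p) n =
  let t , dt = completeness p (suc n)
  in shut t , ⊢shut dt

theorem1 : (A : Form) → IK A ⇔ Σ Tm (λ t → · ⊢ t ∶ A)
theorem1 A = mk⇔ (λ p → completeness p 0) (λ (_ , d) → soundness d)
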